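{- Let $s,t\ge 2$ be coprime integers. If $\lambda$ is a partition that is $s$-regular and $t$-distinct, then $\phi_s(\phi_t(\lambda))$ is $t$-regular and $s$-distinct.
   Context: A partition is $m$-regular if none of its parts is divisible by $m$, and $m$-distinct if no part appears $m$ or more times. For an integer $m\ge 2$, Glaisher's map $\phi_m$ on partitions is defined as follows. Every positive integer is uniquely $jm^k$ with $m\nmid j$, $k\ge 0$. For a partition $\lambda$, if the part $jm^k$ appears in $\lambda$ with multiplicity whose base-$m$ expansion is $\sum_{\ell\ge 0} a_{k,\ell}m^\ell$ ($0\le a_{k,\ell}<m$), then $\phi_m(\lambda)$ is the partition in which, for each $j$ with $m\nmid j$ and each $\ell\ge0$, the part $jm^\ell$ appears $\sum_{k\ge 0} a_{k,\ell}m^k$ times. (Thus $\phi_m$ preserves the sum of parts.) -}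

module Defs where

open import Data.Nat using (ℕ; zero; suc; _+_; _*_; _^_; _<_; _≟_; NonZero)
open import Data.Nat.DivMod using (_/_; _%_)
open import Data.Nat.Divisibility using (_∣_)
open import Data.Product using (_×_; _,_)
open import Data.List using (List; []; _∷_; deduplicate; concatMap; replicate; upTo)
open import Data.List.Relation.Unary.All using (All)
open import Relation.Nullary using (¬_; yes; no)

-- A partition is represented by the (unordered) list of its parts; all
-- parts must be positive.  Order of the list is irrelevant.
IsPartition : List ℕ → Set
IsPartition λ′ = All (λ p → 0 < p) λ′

mult : ℕ → List ℕ → ℕ
mult p []       = 0
mult p (q ∷ qs) with p ≟ q
... | yes _ = suc (mult p qs)
... | no  _ = mult p qs

Regular : ℕ → List ℕ → Set
Regular m λ′ = All (λ p → ¬ (m ∣ p)) λ′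

Distinct : ℕ → List ℕ → Set
Distinct m λ′ = ∀ p → mult p λ′ < m

digit : (m : ℕ) .{{_ : NonZero m}} → ℕ → ℕ → ℕ
digit m c zero    = c % m
digit m c (suc ℓ) = digit m (c / m) ℓ

-- split m fuel p = (j , k) with p = j * m ^ k and m ∤ j  (for p ≥ 1, m ≥ 2,
-- fuel ≥ p suffices)
split : (m : ℕ) .{{_ : NonZero m}} → ℕ → ℕ → ℕ × ℕ
split m zero    p = p , 0
split m (suc f) p with p % m ≟ 0
... | no  _ = p , 0
... | yes _ with split m f (p / m)
...   | j , k = j , suc k

-- contribution of the part p = j m^k occurring c = Σ_ℓ a_ℓ m^ℓ times:
-- the part j m^ℓ with multiplicity a_ℓ m^k, for every ℓ (digits with
-- ℓ ≥ c vanish since c < m^c).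
contrib : (m : ℕ) .{{_ : NonZero m}} → ℕ → ℕ → List ℕ
contrib m p c with split m p p
... | j , k = concatMap (λ ℓ → replicate (digit m c ℓ * m ^ k) (j * m ^ ℓ)) (upTo (suc c))

-- Glaisher's map φ_m (only meaningful for m ≥ 2; m = 0 is a dummy case).
-- The multiplicity of j m^ℓ in the result is Σ_k a_{k,ℓ} m^k, as in the paper.
glaisher : ℕ → List ℕ → List ℕ
glaisher zero    λ′ = λ′
glaisher (suc m) λ′ =
  concatMap (λ p → contrib (suc m) p (mult p λ′)) (deduplicate _≟_ λ′)

-- φ_t sends a part j t^k (with t ∤ j) of multiplicity c to parts j t^ℓ of
-- multiplicity (ℓ-th base-t digit of c) t^k; when λ is t-distinct, c < t has
-- the single digit c, so φ_t only strips powers of t and φ_t(λ) is t-regular.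
-- Every part of any φ_m(λ) is a divisor of a part of λ times a power of m, so
-- φ_m preserves d-regularity for d coprime to m: hence φ_t(λ) stays s-regular
-- and φ_s(φ_t(λ)) stays t-regular.  Finally, on an s-regular partition φ_s
-- sends each part p to the parts p s^ℓ with multiplicity a digit of base s, and
-- p s^ℓ determines p and ℓ, so the result is s-distinct.
module Submission where

open import Defs
open import Data.Nat using (ℕ; _≤_)
open import Data.Nat.Coprimality using (Coprime)
open import Data.List using (List)
open import Data.Product using (_×_)

open import Data.Nat using (zero; suc; _+_; _*_; _^_; _<_; _≟_; NonZero; >-nonZero; z≤n; s≤s; z<s)
open import Data.Nat.Properties
open import Data.Nat.DivMod
  using (_/_; _%_; m%n<n; m*n%n≡0; 0/n≡0; m/n<m; m/n*n≡m; m<n⇒m/n≡0; m≥n⇒m/n>0)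
open import Data.Nat.Divisibility
  using (_∣_; m%n≡0⇒n∣m; n∣m⇒m%n≡0; ∣-trans; ∣⇒≤; m∣m*n; ∣n⇒∣m*n)
import Data.Nat.Coprimality as Coprimality
open import Data.Product using (_,_; proj₁; proj₂; ∃; ∃₂)
open import Data.List using ([]; _∷_; _++_; concatMap; replicate; upTo; deduplicate)
open import Data.List.Relation.Unary.All as All using (All)
open import Data.List.Relation.Unary.Any using (here; there)
open import Data.List.Relation.Unary.AllPairs using ([]; _∷_)
open import Data.List.Relation.Unary.Unique.Propositional using (Unique)
open import Data.List.Relation.Unary.Unique.Propositional.Properties using (upTo⁺)
open import Data.List.Relation.Unary.Unique.DecPropositional.Properties using (deduplicate-!)
open import Data.List.Membership.Propositional using (_∈_; _∉_; find)
open import Data.List.Membership.Propositional.Properties using (∈-concatMap⁻; ∈-deduplicate⁻)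
open import Data.List.Membership.DecPropositional _≟_ using (_∈?_)
open import Function using (_∘_)
open import Relation.Nullary using (¬_; yes; no; contradiction)
open import Relation.Binary.PropositionalEquality

*^-suc : ∀ m x ℓ → x * m ^ suc ℓ ≡ x * m ^ ℓ * m
*^-suc m x ℓ = trans (cong (x *_) (*-comm m (m ^ ℓ))) (sym (*-assoc x (m ^ ℓ) m))

coprime-∤-*^ : ∀ {d m p} ℓ → Coprime d m → ¬ d ∣ p → ¬ d ∣ p * m ^ ℓ
coprime-∤-*^ {d} zero    cop d∤p = d∤p ∘ subst (d ∣_) (*-identityʳ _)
coprime-∤-*^ {d} {m} {p} (suc ℓ) cop d∤p =
  coprime-∤-*^ ℓ cop d∤p ∘ Coprimality.coprime-divisor cop ∘ subst (d ∣_) p*mˡ⁺¹≡m*p*mˡ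
  where
  p*mˡ⁺¹≡m*p*mˡ : p * m ^ suc ℓ ≡ m * (p * m ^ ℓ)
  p*mˡ⁺¹≡m*p*mˡ = trans (*^-suc m p ℓ) (*-comm (p * m ^ ℓ) m)

module _ (m : ℕ) .{{_ : NonZero m}} where

  split-*^ : ∀ f p → proj₁ (split m f p) * m ^ proj₂ (split m f p) ≡ p
  split-*^ zero    p = *-identityʳ p
  split-*^ (suc f) p with p % m ≟ 0
  ... | no  _ = *-identityʳ p
  ... | yes p%m≡0 with split m f (p / m) | split-*^ f (p / m)
  ...   | j , k | j*mᵏ≡p/m = begin
    j * m ^ suc k  ≡⟨ *^-suc m j k ⟩
    j * m ^ k * m  ≡⟨ cong (_* m) j*mᵏ≡p/m ⟩
    p / m * m      ≡⟨ m/n*n≡m (m%n≡0⇒n∣m p m p%m≡0) ⟩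
    p              ∎
    where open ≡-Reasoning

  split-∣ : ∀ f p → proj₁ (split m f p) ∣ p
  split-∣ f p = subst (proj₁ (split m f p) ∣_) (split-*^ f p) (m∣m*n _)

  -- The fuel f ≥ p suffices because p / m < p.
  split-∤ : 1 < m → ∀ f p → 0 < p → p ≤ f → ¬ m ∣ proj₁ (split m f p)
  split-∤ 1<m zero    (suc _) _ ()
  split-∤ 1<m (suc f) p 0<p p≤1+f with p % m ≟ 0
  ... | no  p%m≢0 = p%m≢0 ∘ n∣m⇒m%n≡0 p m
  ... | yes p%m≡0 with split m f (p / m) | split-∤ 1<m f (p / m) 0<p/m p/m≤f
    where
    instance
      p-nonZero : NonZero p
      p-nonZero = >-nonZero 0<p
    0<p/m : 0 < p / m
    0<p/m = m≥n⇒m/n>0 (∣⇒≤ (m%n≡0⇒n∣m p m p%m≡0))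
    p/m≤f : p / m ≤ f
    p/m≤f = ≤-pred (≤-trans (m/n<m p m 1<m) p≤1+f)
  ...   | j , k | m∤j = m∤j

  split-of-∤ : ∀ f p → ¬ m ∣ p → split m f p ≡ (p , 0)
  split-of-∤ zero    p m∤p = refl
  split-of-∤ (suc f) p m∤p with p % m ≟ 0
  ... | yes p%m≡0 = contradiction (m%n≡0⇒n∣m p m p%m≡0) m∤p
  ... | no  _     = refl

  digit-< : ∀ c ℓ → digit m c ℓ < m
  digit-< c zero    = m%n<n c m
  digit-< c (suc ℓ) = digit-< (c / m) ℓ

  digit-of-zero : ∀ ℓ → digit m 0 ℓ ≡ 0
  digit-of-zero zero    = m*n%n≡0 0 m
  digit-of-zero (suc ℓ) = trans (cong (λ c → digit m c ℓ) (0/n≡0 m)) (digit-of-zero ℓ)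

  digit-suc-of-< : ∀ {c} ℓ → c < m → digit m c (suc ℓ) ≡ 0
  digit-suc-of-< ℓ c<m = trans (cong (λ c → digit m c ℓ) (m<n⇒m/n≡0 c<m)) (digit-of-zero ℓ)

  *^-injective : ∀ {p p′} ℓ ℓ′ → ¬ m ∣ p → ¬ m ∣ p′ →
                 p * m ^ ℓ ≡ p′ * m ^ ℓ′ → p ≡ p′ × ℓ ≡ ℓ′
  *^-injective {p} {p′} zero zero _ _ eq =
    trans (sym (*-identityʳ p)) (trans eq (*-identityʳ p′)) , refl
  *^-injective {p} {p′} zero (suc ℓ′) m∤p _ eq =
    contradiction (subst (m ∣_) (trans (sym eq) (*-identityʳ p)) (∣n⇒∣m*n p′ (m∣m*n (m ^ ℓ′)))) m∤p
  *^-injective {p} {p′} (suc ℓ) zero _ m∤p′ eq =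
    contradiction (subst (m ∣_) (trans eq (*-identityʳ p′)) (∣n⇒∣m*n p (m∣m*n (m ^ ℓ)))) m∤p′
  *^-injective {p} {p′} (suc ℓ) (suc ℓ′) m∤p m∤p′ eq =
    let p≡p′ , ℓ≡ℓ′ = *^-injective ℓ ℓ′ m∤p m∤p′ (*-cancelʳ-≡ _ _ m eq′) in p≡p′ , cong suc ℓ≡ℓ′
    where
    eq′ : p * m ^ ℓ * m ≡ p′ * m ^ ℓ′ * m
    eq′ = trans (sym (*^-suc m p ℓ)) (trans eq (*^-suc m p′ ℓ′))

mult-++ : ∀ q xs ys → mult q (xs ++ ys) ≡ mult q xs + mult q ys
mult-++ q []       ys = refl
mult-++ q (x ∷ xs) ys with q ≟ x
... | yes _ = cong suc (mult-++ q xs ys)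
... | no  _ = mult-++ q xs ys

∉⇒mult≡0 : ∀ {q} xs → q ∉ xs → mult q xs ≡ 0
∉⇒mult≡0 {q} []       _   = refl
∉⇒mult≡0 {q} (x ∷ xs) q∉ with q ≟ x
... | yes q≡x = contradiction (here q≡x) q∉
... | no  _   = ∉⇒mult≡0 xs (q∉ ∘ there)

mult-replicate-≤ : ∀ q n x → mult q (replicate n x) ≤ n
mult-replicate-≤ q zero    x = z≤n
mult-replicate-≤ q (suc n) x with q ≟ x
... | yes _ = s≤s (mult-replicate-≤ q n x)
... | no  _ = m≤n⇒m≤1+n (mult-replicate-≤ q n x)

∈-replicate⁻ : ∀ {A : Set} {q : A} n {x} → q ∈ replicate n x → n ≢ 0 × q ≡ x
∈-replicate⁻ (suc n) (here q≡x) = (λ ()) , q≡x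
∈-replicate⁻ (suc n) (there q∈) = (λ ()) , proj₂ (∈-replicate⁻ n q∈)

mult-concatMap-< : ∀ {A : Set} (f : A → List ℕ) {q b} {xs : List A} → 0 < b → Unique xs →
  (∀ {a} → a ∈ xs → mult q (f a) < b) →
  (∀ {a a′} → a ∈ xs → a′ ∈ xs → q ∈ f a → q ∈ f a′ → a ≡ a′) →
  mult q (concatMap f xs) < b
mult-concatMap-< f 0<b [] _ _ = 0<b
mult-concatMap-< f {q} {b} {x ∷ xs} 0<b (x∉xs ∷ unique) bound disjoint with q ∈? f x
... | yes q∈fx = begin-strict
  mult q (f x ++ concatMap f xs)             ≡⟨ mult-++ q (f x) _ ⟩
  mult q (f x) + mult q (concatMap f xs)     ≡⟨ cong (mult q (f x) +_) (∉⇒mult≡0 _ q∉rest) ⟩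
  mult q (f x) + 0                           ≡⟨ +-identityʳ _ ⟩
  mult q (f x)                               <⟨ bound (here refl) ⟩
  b                                          ∎
  where
  open ≤-Reasoning
  q∉rest : q ∉ concatMap f xs
  q∉rest q∈ = let a , a∈xs , q∈fa = find (∈-concatMap⁻ f q∈) in
    All.lookup x∉xs a∈xs (disjoint (here refl) (there a∈xs) q∈fx q∈fa)
... | no q∉fx = begin-strict
  mult q (f x ++ concatMap f xs)             ≡⟨ mult-++ q (f x) _ ⟩
  mult q (f x) + mult q (concatMap f xs)     ≡⟨ cong (_+ _) (∉⇒mult≡0 _ q∉fx) ⟩
  mult q (concatMap f xs)                    <⟨ rest ⟩
  b                                          ∎
  where
  open ≤-Reasoning
  rest : mult q (concatMap f xs) < b
  rest = mult-concatMap-< f 0<b unique (bound ∘ there) (λ a∈ a′∈ → disjoint (there a∈) (there a′∈))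

contrib-∈⁻ : ∀ m .{{_ : NonZero m}} p c {q} → q ∈ contrib m p c →
  ∃ λ ℓ → digit m c ℓ ≢ 0 × q ≡ proj₁ (split m p p) * m ^ ℓ
contrib-∈⁻ m p c q∈ with split m p p
... | j , k =
  let ℓ , _ , q∈block   = find (∈-concatMap⁻ _ {xs = upTo (suc c)} q∈)
      count≢0 , q≡j*mˡ = ∈-replicate⁻ (digit m c ℓ * m ^ k) q∈block
  in ℓ , count≢0 ∘ cong (_* m ^ k) , q≡j*mˡ

glaisher-∈⁻ : ∀ m {λ′ q} → q ∈ glaisher (suc m) λ′ →
  ∃₂ λ p ℓ → p ∈ λ′ × digit (suc m) (mult p λ′) ℓ ≢ 0 × q ≡ proj₁ (split (suc m) p p) * suc m ^ ℓ
glaisher-∈⁻ m {λ′} q∈ =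
  let p , p∈ , q∈contrib = find (∈-concatMap⁻ _ {xs = deduplicate _≟_ λ′} q∈)
      ℓ , digit≢0 , q≡  = contrib-∈⁻ (suc m) p (mult p λ′) q∈contrib
  in p , ℓ , ∈-deduplicate⁻ _≟_ λ′ p∈ , digit≢0 , q≡

glaisher-preserves-regular : ∀ {d} m {λ′} → Coprime d m → Regular d λ′ → Regular d (glaisher m λ′)
glaisher-preserves-regular zero    _   reg = reg
glaisher-preserves-regular {d} (suc m) cop reg = All.tabulate λ q∈ →
  let p , ℓ , p∈ , _ , q≡ = glaisher-∈⁻ m q∈ in
  subst (λ q → ¬ d ∣ q) (sym q≡)
    (coprime-∤-*^ ℓ cop (λ d∣j → All.lookup reg p∈ (∣-trans d∣j (split-∣ (suc m) p p))))

glaisher-distinct⇒regular : ∀ m {λ′} → 2 ≤ m → IsPartition λ′ → Distinct m λ′ →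
                            Regular m (glaisher m λ′)
glaisher-distinct⇒regular (suc m) {λ′} 2≤m pos dis = All.tabulate λ q∈ →
  let p , ℓ , p∈ , digit≢0 , q≡ = glaisher-∈⁻ m q∈ in
  subst (λ q → ¬ suc m ∣ q) (sym q≡) (free-part-∤ ℓ p∈ digit≢0)
  where
  free-part-∤ : ∀ {p} ℓ → p ∈ λ′ → digit (suc m) (mult p λ′) ℓ ≢ 0 →
                ¬ suc m ∣ proj₁ (split (suc m) p p) * suc m ^ ℓ
  free-part-∤ {p} zero p∈ _ =
    split-∤ (suc m) 2≤m p p (All.lookup pos p∈) ≤-refl ∘ subst (suc m ∣_) (*-identityʳ _)
  free-part-∤ {p} (suc ℓ) _ digit≢0 = contradiction (digit-suc-of-< (suc m) ℓ (dis p)) digit≢0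

contrib-mult-< : ∀ m .{{_ : NonZero m}} → 1 < m → ∀ {p} c q → ¬ m ∣ p → mult q (contrib m p c) < m
contrib-mult-< m 1<m {p} c q m∤p with split m p p | split-of-∤ m p p m∤p
... | .(p , 0) | refl = mult-concatMap-< _ (<-trans z<s 1<m) (upTo⁺ (suc c)) bound disjoint
  where
  block : ℕ → List ℕ
  block ℓ = replicate (digit m c ℓ * m ^ 0) (p * m ^ ℓ)
  bound : ∀ {ℓ} → ℓ ∈ upTo (suc c) → mult q (block ℓ) < m
  bound {ℓ} _ = ≤-<-trans (mult-replicate-≤ q _ _) (subst (_< m) (sym (*-identityʳ _)) (digit-< m c ℓ))
  disjoint : ∀ {ℓ ℓ′} → ℓ ∈ upTo (suc c) → ℓ′ ∈ upTo (suc c) → q ∈ block ℓ → q ∈ block ℓ′ → ℓ ≡ ℓ′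
  disjoint {ℓ} {ℓ′} _ _ q∈ q∈′ = proj₂ (*^-injective m ℓ ℓ′ m∤p m∤p
    (trans (sym (proj₂ (∈-replicate⁻ _ q∈))) (proj₂ (∈-replicate⁻ _ q∈′))))

glaisher-regular⇒distinct : ∀ m {λ′} → 2 ≤ m → Regular m λ′ → Distinct m (glaisher m λ′)
glaisher-regular⇒distinct (suc m) {λ′} 2≤m reg q =
  mult-concatMap-< _ z<s (deduplicate-! _≟_ λ′) bound disjoint
  where
  parts : List ℕ
  parts = deduplicate _≟_ λ′
  m∤ : ∀ {p} → p ∈ parts → ¬ suc m ∣ p
  m∤ p∈ = All.lookup reg (∈-deduplicate⁻ _≟_ λ′ p∈)
  bound : ∀ {p} → p ∈ parts → mult q (contrib (suc m) p (mult p λ′)) < suc m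
  bound {p} p∈ = contrib-mult-< (suc m) 2≤m {p} (mult p λ′) q (m∤ p∈)
  shape : ∀ {p} → p ∈ parts → q ∈ contrib (suc m) p (mult p λ′) → ∃ λ ℓ → q ≡ p * suc m ^ ℓ
  shape {p} p∈ q∈ =
    let ℓ , _ , q≡ = contrib-∈⁻ (suc m) p (mult p λ′) q∈ in
    ℓ , trans q≡ (cong (λ j → proj₁ j * suc m ^ ℓ) (split-of-∤ (suc m) p p (m∤ p∈)))
  disjoint : ∀ {p p′} → p ∈ parts → p′ ∈ parts →
             q ∈ contrib (suc m) p (mult p λ′) → q ∈ contrib (suc m) p′ (mult p′ λ′) → p ≡ p′
  disjoint p∈ p′∈ q∈ q∈′ =
    let ℓ , q≡ = shape p∈ q∈ ; ℓ′ , q≡′ = shape p′∈ q∈′ in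
    proj₁ (*^-injective (suc m) ℓ ℓ′ (m∤ p∈) (m∤ p′∈) (trans (sym q≡) q≡′))

theorem6 : (s t : ℕ) → 2 ≤ s → 2 ≤ t → Coprime s t →
    (λ′ : List ℕ) → IsPartition λ′ → Regular s λ′ → Distinct t λ′ →
    Regular t (glaisher s (glaisher t λ′)) × Distinct s (glaisher s (glaisher t λ′))
theorem6 s t 2≤s 2≤t cop λ′ pos reg dis =
  glaisher-preserves-regular s (Coprimality.sym cop) μ-t-regular ,
  glaisher-regular⇒distinct s 2≤s μ-s-regular
  where
  μ-t-regular : Regular t (glaisher t λ′)
  μ-t-regular = glaisher-distinct⇒regular t 2≤t pos dis
  μ-s-regular : Regular s (glaisher t λ′)
  μ-s-regular = glaisher-preserves-regular t cop reg
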